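{- Let $n$ be a positive integer and $0 \le k \le n-1$. Let $\mathcal{N}(n,k)$ be the set of all permutations of $[n]=\{1,\dots,n\}$ that have exactly $k$ ascents and are not parity alternating. Then the number of even permutations in $\mathcal{N}(n,k)$ equals the number of odd permutations in $\mathcal{N}(n,k)$.
   Context: A permutation $a_1a_2\cdots a_n$ of $[n]$ (in one-line notation) is parity alternating if its entries are alternately even and odd, i.e. $a_i$ and $a_{i+1}$ have different parities for every $1\le i\le n-1$. An ascent of $a_1\cdots a_n$ is an index $i$ ($1\le i\le n-1$) with $a_i<a_{i+1}$. An inversion is a pair $(i,j)$ with $1\le i<j\le n$ and $a_i>a_j$; a permutation is even or odd according to whether its number of inversions is even or odd. -}

module Defs where

open import Data.Nat using (ℕ; zero; suc; _+_; _<_; _<ᵇ_; _%_)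
open import Data.Bool using (Bool; true; false; not; _∧_; if_then_else_)
open import Data.Fin using (Fin; toℕ)
open import Data.Fin.Properties using (all?)
open import Data.List using (List; []; _∷_; length; filter; concatMap; map; allFin)
open import Data.Vec using (Vec; []; _∷_; lookup; toList)
open import Relation.Nullary using (Dec; yes; no; ¬_; _×-dec_; ¬?)
open import Relation.Nullary.Decidable using (_→-dec_)
open import Relation.Binary.PropositionalEquality using (_≡_)
open import Data.Nat.Base using (_≡ᵇ_)
import Data.Nat.Properties as ℕP
import Data.Bool.Properties as BP
import Data.Fin.Properties as FP

allWords : (n m : ℕ) → List (Vec (Fin n) m)
allWords n zero    = [] ∷ []
allWords n (suc m) = concatMap (λ x → map (x ∷_) (allWords n m)) (allFin n)

-- A word w over Fin n of length n is a permutation of [n] iff it is injective.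
-- (The entry at position i is a_{i+1} = toℕ (lookup w i) + 1.)
IsPerm : ∀ {n} → Vec (Fin n) n → Set
IsPerm {n} w = (i j : Fin n) → lookup w i ≡ lookup w j → i ≡ j

isPerm? : ∀ {n} (w : Vec (Fin n) n) → Dec (IsPerm w)
isPerm? {n} w =
  all? λ i → all? λ j → (lookup w i FP.≟ lookup w j) →-dec (i FP.≟ j)

oneLine : ∀ {n} → Vec (Fin n) n → List ℕ
oneLine w = map (λ x → suc (toℕ x)) (toList w)

ascents : List ℕ → ℕ
ascents []           = 0
ascents (a ∷ [])     = 0
ascents (a ∷ b ∷ as) = (if a <ᵇ b then 1 else 0) + ascents (b ∷ as)

invFrom : ℕ → List ℕ → ℕ
invFrom a []       = 0
invFrom a (b ∷ bs) = (if b <ᵇ a then 1 else 0) + invFrom a bs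

inversions : List ℕ → ℕ
inversions []       = 0
inversions (a ∷ as) = invFrom a as + inversions as

parityAlternating : List ℕ → Bool
parityAlternating []           = true
parityAlternating (a ∷ [])     = true
parityAlternating (a ∷ b ∷ as) = not (a % 2 ≡ᵇ b % 2) ∧ parityAlternating (b ∷ as)

perms : (n : ℕ) → List (Vec (Fin n) n)
perms n = filter isPerm? (allWords n n)

countN : (n k r : ℕ) → ℕ
countN n k r = length (filter (λ w → let a = oneLine w in
    (ascents a ℕP.≟ k) ×-dec (parityAlternating a BP.≟ false)
      ×-dec (inversions a % 2 ℕP.≟ r))
  (perms n))

{-# OPTIONS --with-K #-}
-- Call consecutive values v and v + 1 tied in a permutation when they occupy positions of the
-- same parity. A permutation without ties is parity alternating: the parity of a value plus the
-- parity of its position is then the same for all values. On the other permutations, swapping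
-- the values of the first tie is a sign-reversing involution. Tied values are never adjacent, so
-- the ascents are kept; the number of inversions changes by exactly one; and the position
-- parities of all values are kept, so the first tie stays the same and the image is again not
-- parity alternating.
module Submission where

open import Defs
open import Data.Bool.Base using (Bool; true; false; not; _∧_; if_then_else_)
open import Data.Bool.Properties as Boolₚ using (¬-not; ∧-conicalˡ; ∧-conicalʳ)
open import Data.Fin.Base as Fin using (Fin; toℕ; inject₁; fromℕ<; punchOut)
import Data.Fin.Properties as Finₚ
import Data.List.Base as List
open import Data.List.Base
  using (List; []; _∷_; _++_; map; filter; length; find; concatMap; cartesianProductWith; allFin)
open import Data.List.Properties using (length-map; map-∘; map-cong; map-id)
open import Data.List.Membership.Propositional using (_∈_; _∉_)
open import Data.List.Membership.Propositional.Properties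
  using (∈-map⁺; ∈-map⁻; ∈-filter⁺; ∈-filter⁻; ∈-allFin; ∈-cartesianProductWith⁺)
open import Data.List.Membership.Propositional.Properties.WithK using (unique∧set⇒bag)
open import Data.List.Relation.Binary.BagAndSetEquality using (∼bag⇒↭)
open import Data.List.Relation.Binary.Permutation.Propositional.Properties using (↭-length)
open import Data.List.Relation.Unary.All as All using (All; []; _∷_)
open import Data.List.Relation.Unary.AllPairs using ([]; _∷_)
open import Data.List.Relation.Unary.Any as Any using (here; there)
open import Data.List.Relation.Unary.Linked as Linked using (Linked; []; [-]; _∷_)
open import Data.List.Relation.Unary.Unique.Propositional using (Unique)
import Data.List.Relation.Unary.Unique.Propositional.Properties as Unique
open import Data.Maybe.Base using (Maybe; just; nothing; maybe′)
open import Data.Maybe.Properties using (just-injective)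
open import Data.Nat.Base using (ℕ; zero; suc; _+_; _∸_; _<_; _%_; _<ᵇ_; _≡ᵇ_; s≤s; parity)
open import Data.Nat.Properties using (_≟_; +-suc; suc-injective; <-irrefl; n<1+n; m<n⇒m<1+n)
open import Data.Parity.Base as ℙ using (Parity; 0ℙ; 1ℙ; _⁻¹)
import Data.Parity.Properties as ℙₚ
open import Data.Product using (∃; _×_; _,_; proj₂)
open import Data.Sum using (_⊎_; inj₁; inj₂)
open import Data.Vec.Base as Vec using (Vec; []; _∷_; lookup; toList)
import Data.Vec.Properties as Vecₚ
open import Data.Vec.Membership.Propositional.Properties using (∈-lookup; ∈-toList⁺)
open import Function.Base using (_∘_)
open import Function.Bundles using (_⇔_; mk⇔; Equivalence)
open import Relation.Binary.Definitions using (DecidableEquality)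
open import Relation.Binary.PropositionalEquality
  using (_≡_; _≢_; refl; sym; trans; cong; cong₂; subst; module ≡-Reasoning)
open import Relation.Nullary using (¬_; Dec; yes; no; does; contradiction; _×-dec_)
open import Relation.Nullary.Decidable using (dec-true; dec-false)
open import Relation.Unary using (Decidable)

open ≡-Reasoning

n<ᵇ1+n : ∀ n → (n <ᵇ suc n) ≡ true
n<ᵇ1+n zero    = refl
n<ᵇ1+n (suc n) = n<ᵇ1+n n

1+n<ᵇn : ∀ n → (suc n <ᵇ n) ≡ false
1+n<ᵇn zero    = refl
1+n<ᵇn (suc n) = 1+n<ᵇn n

suc-<ᵇ : ∀ x b → b ≢ suc x → (suc x <ᵇ b) ≡ (x <ᵇ b)
suc-<ᵇ x       zero          _   = refl
suc-<ᵇ zero    (suc zero)    b≢1 = contradiction refl b≢1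
suc-<ᵇ zero    (suc (suc b)) _   = refl
suc-<ᵇ (suc x) (suc b)       b≢  = suc-<ᵇ x b (b≢ ∘ cong suc)

<ᵇ-suc : ∀ a x → a ≢ x → (a <ᵇ suc x) ≡ (a <ᵇ x)
<ᵇ-suc zero    zero    a≢x = contradiction refl a≢x
<ᵇ-suc zero    (suc x) _   = refl
<ᵇ-suc (suc a) zero    _   = refl
<ᵇ-suc (suc a) (suc x) a≢x = <ᵇ-suc a x (a≢x ∘ cong suc)

DifferByOne : ℕ → ℕ → Set
DifferByOne m n = m ≡ suc n ⊎ n ≡ suc m

differByOne-+ˡ : ∀ k {m n} → DifferByOne m n → DifferByOne (k + m) (k + n)
differByOne-+ˡ k {n = n} (inj₁ refl) = inj₁ (+-suc k n)
differByOne-+ˡ k {m = m} (inj₂ refl) = inj₂ (+-suc k m)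

%2-differByOne : ∀ {m n} → DifferByOne m n → m % 2 ≡ 1 ∸ n % 2
%2-differByOne {n = n} (inj₁ refl) = suc-%2 n
  where
  suc-%2 : ∀ n → suc n % 2 ≡ 1 ∸ n % 2
  suc-%2 zero          = refl
  suc-%2 (suc zero)    = refl
  suc-%2 (suc (suc n)) = suc-%2 n
%2-differByOne {m = m} (inj₂ refl) = %2-pred m
  where
  %2-pred : ∀ m → m % 2 ≡ 1 ∸ suc m % 2
  %2-pred zero          = refl
  %2-pred (suc zero)    = refl
  %2-pred (suc (suc m)) = %2-pred m

parity-suc : ∀ n → parity (suc n) ≡ parity n ⁻¹
parity-suc zero          = refl
parity-suc (suc zero)    = refl
parity-suc (suc (suc n)) = parity-suc n

≢⇒≡⁻¹ : ∀ {p q : Parity} → p ≢ q → q ≡ p ⁻¹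
≢⇒≡⁻¹ {0ℙ} {0ℙ} p≢q = contradiction refl p≢q
≢⇒≡⁻¹ {0ℙ} {1ℙ} _   = refl
≢⇒≡⁻¹ {1ℙ} {0ℙ} _   = refl
≢⇒≡⁻¹ {1ℙ} {1ℙ} p≢q = contradiction refl p≢q

⁻¹+⁻¹ : ∀ p q → p ⁻¹ ℙ.+ q ⁻¹ ≡ p ℙ.+ q
⁻¹+⁻¹ 0ℙ 0ℙ = refl
⁻¹+⁻¹ 0ℙ 1ℙ = refl
⁻¹+⁻¹ 1ℙ 0ℙ = refl
⁻¹+⁻¹ 1ℙ 1ℙ = refl

%2-differ⇔ : ∀ a b → not (a % 2 ≡ᵇ b % 2) ≡ true ⇔ parity b ≡ parity a ⁻¹
%2-differ⇔ zero          zero          = mk⇔ (λ ()) (λ ())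
%2-differ⇔ zero          (suc zero)    = mk⇔ (λ _ → refl) (λ _ → refl)
%2-differ⇔ (suc zero)    zero          = mk⇔ (λ _ → refl) (λ _ → refl)
%2-differ⇔ (suc zero)    (suc zero)    = mk⇔ (λ ()) (λ ())
%2-differ⇔ (suc (suc a)) b             = %2-differ⇔ a b
%2-differ⇔ a             (suc (suc b)) = %2-differ⇔ a b

length-≡-by-involution :
  ∀ {A : Set} (f : A → A) → (∀ x → f (f x) ≡ x) →
  ∀ {xs ys : List A} → Unique xs → Unique ys →
  (∀ {x} → x ∈ xs → f x ∈ ys) → (∀ {y} → y ∈ ys → f y ∈ xs) →
  length xs ≡ length ys
length-≡-by-involution f f∘f≡id {xs} {ys} xs! ys! xs→ys ys→xs = begin
  length xs          ≡⟨ length-map f xs ⟨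
  length (map f xs)  ≡⟨ ↭-length (∼bag⇒↭ (unique∧set⇒bag (Unique.map⁺ f-injective xs!) ys!
                                                           (mk⇔ image⊆ys ys⊆image))) ⟩
  length ys          ∎
  where
  f-injective : ∀ {x y} → f x ≡ f y → x ≡ y
  f-injective {x} {y} fx≡fy = trans (sym (f∘f≡id x)) (trans (cong f fx≡fy) (f∘f≡id y))
  image⊆ys : ∀ {z} → z ∈ map f xs → z ∈ ys
  image⊆ys z∈ with _ , x∈ , refl ← ∈-map⁻ f z∈ = xs→ys x∈
  ys⊆image : ∀ {y} → y ∈ ys → y ∈ map f xs
  ys⊆image {y} y∈ = subst (_∈ map f xs) (f∘f≡id y) (∈-map⁺ f (ys→xs y∈))

mapWithin : ∀ {A : Set} {P : A → Set} {R S : A → A → Set} →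
            (∀ {a b} → P a → P b → R a b → S a b) → ∀ {l} → All P l → Linked R l → Linked S l
mapWithin f _                  []       = []
mapWithin f _                  [-]      = [-]
mapWithin f (pa ∷ pbs@(pb ∷ _)) (r ∷ rs) = f pa pb r ∷ mapWithin f pbs rs

module _ {A : Set} {P : A → Set} (P? : Decidable P) where

  find-just : ∀ xs {x} → find P? xs ≡ just x → P x
  find-just (y ∷ ys) eq with P? y
  ... | yes py = subst P (just-injective eq) py
  ... | no _   = find-just ys eq

  find-nothing : ∀ xs → find P? xs ≡ nothing → All (¬_ ∘ P) xs
  find-nothing []       _  = []
  find-nothing (y ∷ ys) eq with P? y
  ... | no ¬py = ¬py ∷ find-nothing ys eq

find-cong : ∀ {A : Set} {P Q : A → Set} (P? : Decidable P) (Q? : Decidable Q) →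
            (∀ x → does (P? x) ≡ does (Q? x)) → ∀ xs → find P? xs ≡ find Q? xs
find-cong P? Q? same []       = refl
find-cong P? Q? same (x ∷ xs) =
  cong₂ (λ b rest → if b then just x else rest) (same x) (find-cong P? Q? same xs)

concatMap-map≡cartesianProductWith :
  ∀ {A B C : Set} (f : A → B → C) xs ys →
  concatMap (λ x → map (f x) ys) xs ≡ cartesianProductWith f xs ys
concatMap-map≡cartesianProductWith f []       ys = refl
concatMap-map≡cartesianProductWith f (x ∷ xs) ys =
  cong (map (f x) ys ++_) (concatMap-map≡cartesianProductWith f xs ys)

module _ {A : Set} (_≟ᴬ_ : DecidableEquality A) where

  transpose : A → A → A → A
  transpose a b v = if does (v ≟ᴬ a) then b else if does (v ≟ᴬ b) then a else v

  transpose-matchˡ : ∀ a b → transpose a b a ≡ b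
  transpose-matchˡ a b rewrite dec-true (a ≟ᴬ a) refl = refl

  transpose-matchʳ : ∀ a b → transpose a b b ≡ a
  transpose-matchʳ a b with b ≟ᴬ a
  ... | yes refl = refl
  ... | no _ rewrite dec-true (b ≟ᴬ b) refl = refl

  transpose-fixes : ∀ {a b v} → v ≢ a → v ≢ b → transpose a b v ≡ v
  transpose-fixes {a} {b} {v} v≢a v≢b rewrite dec-false (v ≟ᴬ a) v≢a | dec-false (v ≟ᴬ b) v≢b = refl

  data Transposes (a b : A) : A → A → Set where
    first  : Transposes a b a b
    second : Transposes a b b a
    fixes  : ∀ {v} → v ≢ a → v ≢ b → Transposes a b v v

  transposes : ∀ a b v → Transposes a b v (transpose a b v)
  transposes a b v with v ≟ᴬ a
  ... | yes refl = first
  ... | no v≢a with v ≟ᴬ b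
  ...   | yes refl = second
  ...   | no v≢b   = fixes v≢a v≢b

  transpose-involutive : ∀ a b v → transpose a b (transpose a b v) ≡ v
  transpose-involutive a b v with transpose a b v | transposes a b v
  ... | _ | first           = transpose-matchʳ a b
  ... | _ | second          = transpose-matchˡ a b
  ... | _ | fixes v≢a v≢b   = transpose-fixes v≢a v≢b

  transpose-injective : ∀ a b {u v} → transpose a b u ≡ transpose a b v → u ≡ v
  transpose-injective a b {u} {v} eq =
    trans (sym (transpose-involutive a b u)) (trans (cong (transpose a b) eq) (transpose-involutive a b v))

transpose-natural : ∀ {A B : Set} (_≟ᴬ_ : DecidableEquality A) (_≟ᴮ_ : DecidableEquality B)
                    (f : A → B) → (∀ {x y} → f x ≡ f y → x ≡ y) →
                    ∀ a b v → f (transpose _≟ᴬ_ a b v) ≡ transpose _≟ᴮ_ (f a) (f b) (f v)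
transpose-natural _≟ᴬ_ _≟ᴮ_ f f-inj a b v with transpose _≟ᴬ_ a b v | transposes _≟ᴬ_ a b v
... | _ | first         = sym (transpose-matchˡ _≟ᴮ_ (f a) (f b))
... | _ | second        = sym (transpose-matchʳ _≟ᴮ_ (f a) (f b))
... | _ | fixes v≢a v≢b = sym (transpose-fixes _≟ᴮ_ (v≢a ∘ f-inj) (v≢b ∘ f-inj))

allWords-suc : ∀ n m → allWords n (suc m) ≡ cartesianProductWith _∷_ (allFin n) (allWords n m)
allWords-suc n m = concatMap-map≡cartesianProductWith _∷_ (allFin n) (allWords n m)

∈-allWords : ∀ n {m} (w : Vec (Fin n) m) → w ∈ allWords n m
∈-allWords n []      = here refl
∈-allWords n (x ∷ w) = subst (x ∷ w ∈_) (sym (allWords-suc n _))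
  (∈-cartesianProductWith⁺ _∷_ (∈-allFin x) (∈-allWords n w))

allWords-unique : ∀ n m → Unique (allWords n m)
allWords-unique n zero    = [] ∷ []
allWords-unique n (suc m) = subst Unique (sym (allWords-suc n m))
  (Unique.cartesianProductWith⁺ _∷_ Vecₚ.∷-injective (Unique.allFin⁺ n) (allWords-unique n m))

perms-unique : ∀ n → Unique (perms n)
perms-unique n = Unique.filter⁺ isPerm? (allWords-unique n n)

∈-perms⁺ : ∀ {n} {w : Vec (Fin n) n} → IsPerm w → w ∈ perms n
∈-perms⁺ {n} {w} = ∈-filter⁺ isPerm? (∈-allWords n w)

∈-perms⁻ : ∀ {n} {w : Vec (Fin n) n} → w ∈ perms n → IsPerm w
∈-perms⁻ {n} w∈ = proj₂ (∈-filter⁻ isPerm? {xs = allWords n n} w∈)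

injective⇒surjective : ∀ {n} (f : Fin n → Fin n) → (∀ {i j} → f i ≡ f j → i ≡ j) →
                       ∀ k → ∃ λ i → f i ≡ k
-- If k were missed, punching it out of f would inject Fin (suc m) into Fin m.
injective⇒surjective f f-inj k with Finₚ.any? (λ i → f i Finₚ.≟ k)
... | yes hit = hit
injective⇒surjective {suc m} f f-inj k | no miss
  with i , j , i<j , eq ← Finₚ.pigeonhole (n<1+n m) (λ i → punchOut {i = k} {j = f i} (miss ∘ (i ,_) ∘ sym))
  = contradiction (cong toℕ (f-inj (Finₚ.punchOut-injective (miss ∘ (i ,_) ∘ sym) (miss ∘ (j ,_) ∘ sym) eq)))
                  (λ i≡j → <-irrefl i≡j i<j)

isPerm-map : ∀ {n} {g : Fin n → Fin n} → (∀ {a b} → g a ≡ g b → a ≡ b) →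
             ∀ {w} → IsPerm w → IsPerm (Vec.map g w)
isPerm-map {g = g} g-inj {w} w-perm i j eq = w-perm i j (g-inj (begin
  g (lookup w i)         ≡⟨ Vecₚ.lookup-map i g w ⟨
  lookup (Vec.map g w) i ≡⟨ eq ⟩
  lookup (Vec.map g w) j ≡⟨ Vecₚ.lookup-map j g w ⟩
  g (lookup w j)         ∎))

toList≡tabulate∘lookup : ∀ {A : Set} {n} (w : Vec A n) → toList w ≡ List.tabulate (lookup w)
toList≡tabulate∘lookup []      = refl
toList≡tabulate∘lookup (x ∷ w) = cong (x ∷_) (toList≡tabulate∘lookup w)

oneLine-unique : ∀ {n} {w : Vec (Fin n) n} → IsPerm w → Unique (oneLine w)
oneLine-unique {w = w} w-perm = Unique.map⁺ (Finₚ.toℕ-injective ∘ suc-injective)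
  (subst Unique (sym (toList≡tabulate∘lookup w)) (Unique.tabulate⁺ (w-perm _ _)))

∈-oneLine : ∀ {n} {w : Vec (Fin n) n} → IsPerm w → ∀ k → suc (toℕ k) ∈ oneLine w
∈-oneLine {w = w} w-perm k with i , refl ← injective⇒surjective (lookup w) (w-perm _ _) k =
  ∈-map⁺ (suc ∘ toℕ) (∈-toList⁺ (∈-lookup i w))

oneLine-values : ∀ {n} {w : Vec (Fin n) n} {v} → v ∈ oneLine w → ∃ λ (k : Fin n) → v ≡ suc (toℕ k)
oneLine-values v∈ with k , _ , eq ← ∈-map⁻ (suc ∘ toℕ) v∈ = k , eq

indicator : Bool → ℕ
indicator b = if b then 1 else 0

ascents-map : ∀ (g : ℕ → ℕ) {l} → Linked (λ a b → (g a <ᵇ g b) ≡ (a <ᵇ b)) l →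
              ascents (map g l) ≡ ascents l
ascents-map g []          = refl
ascents-map g [-]         = refl
ascents-map g (ab ∷ rest) = cong₂ _+_ (cong indicator ab) (ascents-map g rest)

invFrom-map : ∀ (g : ℕ → ℕ) {a a′} t → (∀ {b} → b ∈ t → (g b <ᵇ a′) ≡ (b <ᵇ a)) →
              invFrom a′ (map g t) ≡ invFrom a t
invFrom-map g []      _        = refl
invFrom-map g (b ∷ t) ordered = cong₂ _+_ (cong indicator (ordered (here refl))) (invFrom-map g t (ordered ∘ there))

inversions-map : ∀ (g : ℕ → ℕ) l → (∀ {a b} → a ∈ l → b ∈ l → (g b <ᵇ g a) ≡ (b <ᵇ a)) →
                 inversions (map g l) ≡ inversions l
inversions-map g []      _       = refl
inversions-map g (a ∷ t) ordered = cong₂ _+_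
  (invFrom-map g t (ordered (here refl) ∘ there))
  (inversions-map g t (λ a∈ b∈ → ordered (there a∈) (there b∈)))

-- Positions and the parity defect

position : ℕ → List ℕ → ℕ
position v []      = 0
position v (a ∷ l) = if does (v ≟ a) then 0 else suc (position v l)

position-here : ∀ a l → position a (a ∷ l) ≡ 0
position-here a l rewrite dec-true (a ≟ a) refl = refl

position-there : ∀ {v a} l → v ≢ a → position v (a ∷ l) ≡ suc (position v l)
position-there {v} {a} l v≢a rewrite dec-false (v ≟ a) v≢a = refl

position-map : ∀ (g : ℕ → ℕ) → (∀ {u v} → g u ≡ g v → u ≡ v) →
               ∀ v l → position (g v) (map g l) ≡ position v l
position-map g g-inj v []      = refl
position-map g g-inj v (a ∷ l) with v ≟ a
... | yes refl = trans (position-here (g v) (map g l)) (sym (position-here v l))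
... | no v≢a   = begin
  position (g v) (map g (a ∷ l))  ≡⟨ position-there (map g l) (v≢a ∘ g-inj) ⟩
  suc (position (g v) (map g l))  ≡⟨ cong suc (position-map g g-inj v l) ⟩
  suc (position v l)              ≡⟨ position-there l v≢a ⟨
  position v (a ∷ l)              ∎

positionParity : List ℕ → ℕ → Parity
positionParity l v = parity (position v l)

positionParity-there : ∀ {v a} l → v ≢ a → positionParity (a ∷ l) v ≡ positionParity l v ⁻¹
positionParity-there {v} l v≢a = trans (cong parity (position-there l v≢a)) (parity-suc (position v l))

positionParity-alternates : ∀ {l} → Unique l →
                            Linked (λ a b → positionParity l b ≡ positionParity l a ⁻¹) l
positionParity-alternates {[]}        _        = []
positionParity-alternates {a ∷ []}    _        = [-]
positionParity-alternates {a ∷ b ∷ t} (a∉ ∷ u) =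
  first-step ∷ mapWithin shift a∉ (positionParity-alternates u)
  where
  first-step : positionParity (a ∷ b ∷ t) b ≡ positionParity (a ∷ b ∷ t) a ⁻¹
  first-step rewrite positionParity-there (b ∷ t) (All.head a∉ ∘ sym) | position-here b t
                   | position-here a (b ∷ t) = refl
  shift : ∀ {c d} → a ≢ c → a ≢ d → positionParity (b ∷ t) d ≡ positionParity (b ∷ t) c ⁻¹ →
          positionParity (a ∷ b ∷ t) d ≡ positionParity (a ∷ b ∷ t) c ⁻¹
  shift a≢c a≢d alt = trans (positionParity-there (b ∷ t) (a≢d ∘ sym))
    (trans (cong _⁻¹ alt) (cong _⁻¹ (sym (positionParity-there (b ∷ t) (a≢c ∘ sym)))))

defect : List ℕ → ℕ → Parity
defect l v = positionParity l v ℙ.+ parity v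

defect-here : ∀ a l → defect (a ∷ l) a ≡ parity a
defect-here a l rewrite position-here a l = refl

defect-there : ∀ {v a} l → v ≢ a → defect (a ∷ l) v ≡ defect l v ⁻¹
defect-there {v} l v≢a =
  trans (cong (ℙ._+ parity v) (positionParity-there l v≢a)) (ℙₚ.+-assoc 1ℙ (positionParity l v) (parity v))

defect-suc : ∀ l v → positionParity l (suc v) ≢ positionParity l v → defect l (suc v) ≡ defect l v
defect-suc l v untied = begin
  positionParity l (suc v) ℙ.+ parity (suc v)  ≡⟨ cong₂ ℙ._+_ (≢⇒≡⁻¹ (untied ∘ sym)) (parity-suc v) ⟩
  positionParity l v ⁻¹ ℙ.+ parity v ⁻¹        ≡⟨ ⁻¹+⁻¹ (positionParity l v) (parity v) ⟩
  positionParity l v ℙ.+ parity v              ∎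

alternating⇒defect≡ : ∀ {a t v} → parityAlternating (a ∷ t) ≡ true → v ∈ a ∷ t → defect (a ∷ t) v ≡ parity a
alternating⇒defect≡ {a} {t}     alt (here refl) = defect-here a t
alternating⇒defect≡ {a} {b ∷ t} {v} alt (there v∈) with v ≟ a
... | yes refl = defect-here v (b ∷ t)
... | no v≢a   = begin
  defect (a ∷ b ∷ t) v  ≡⟨ defect-there (b ∷ t) v≢a ⟩
  defect (b ∷ t) v ⁻¹   ≡⟨ cong _⁻¹ (alternating⇒defect≡ (∧-conicalʳ _ _ alt) v∈) ⟩
  parity b ⁻¹           ≡⟨ ℙₚ.⁻¹-selfInverse (sym (Equivalence.to (%2-differ⇔ a b) (∧-conicalˡ _ _ alt))) ⟩
  parity a              ∎

defect≡⇒alternating : ∀ {l c} → Unique l → (∀ {v} → v ∈ l → defect l v ≡ c) → parityAlternating l ≡ true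
defect≡⇒alternating {[]}        _        _        = refl
defect≡⇒alternating {a ∷ []}    _        _        = refl
defect≡⇒alternating {a ∷ b ∷ t} {c} (a∉ ∷ u) constant =
  subst (λ s → s ∧ parityAlternating (b ∷ t) ≡ true) (sym (Equivalence.from (%2-differ⇔ a b) step))
        (defect≡⇒alternating u constant′)
  where
  constant′ : ∀ {v} → v ∈ b ∷ t → defect (b ∷ t) v ≡ c ⁻¹
  constant′ {v} v∈ = sym (ℙₚ.⁻¹-selfInverse
    (trans (sym (defect-there {v} (b ∷ t) (λ { refl → All.lookup a∉ v∈ refl }))) (constant (there v∈))))
  step : parity b ≡ parity a ⁻¹
  step = begin
    parity b              ≡⟨ defect-here b t ⟨
    defect (b ∷ t) b      ≡⟨ constant′ (here refl) ⟩
    c ⁻¹                  ≡⟨ cong _⁻¹ (trans (sym (defect-here a (b ∷ t))) (constant (here refl))) ⟨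
    parity a ⁻¹           ∎

tie⇒¬alternating : ∀ {l x} → x ∈ l → suc x ∈ l → positionParity l x ≡ positionParity l (suc x) →
                   parityAlternating l ≡ false
tie⇒¬alternating {a ∷ t} {x} x∈ sx∈ tie = ¬-not (λ alt → ℙₚ.p≢p⁻¹ (parity x)
  (trans (ℙₚ.+-cancelˡ-≡ (positionParity (a ∷ t) x) _ _ (same-defect alt)) (parity-suc x)))
  where
  same-defect : parityAlternating (a ∷ t) ≡ true → defect (a ∷ t) x ≡ positionParity (a ∷ t) x ℙ.+ parity (suc x)
  same-defect alt = begin
    defect (a ∷ t) x                                ≡⟨ alternating⇒defect≡ alt x∈ ⟩
    parity a                                        ≡⟨ alternating⇒defect≡ alt sx∈ ⟨
    positionParity (a ∷ t) (suc x) ℙ.+ parity (suc x) ≡⟨ cong (ℙ._+ parity (suc x)) tie ⟨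
    positionParity (a ∷ t) x ℙ.+ parity (suc x)     ∎

-- Swapping the values x and x + 1

module Adjacent (x : ℕ) where

  τ : ℕ → ℕ
  τ = transpose _≟_ x (suc x)

  τ-injective : ∀ {u v} → τ u ≡ τ v → u ≡ v
  τ-injective = transpose-injective _≟_ x (suc x)

  SwapPair : ℕ → ℕ → Set
  SwapPair a b = (a ≡ x × b ≡ suc x) ⊎ (a ≡ suc x × b ≡ x)

  τ-<ᵇ : ∀ a b → ¬ SwapPair a b → (τ a <ᵇ τ b) ≡ (a <ᵇ b)
  τ-<ᵇ a b ¬swap with τ a | transposes _≟_ x (suc x) a | τ b | transposes _≟_ x (suc x) b
  ... | _ | first          | _ | first          = refl
  ... | _ | first          | _ | second         = contradiction (inj₁ (refl , refl)) ¬swap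
  ... | _ | first          | _ | fixes b≢x b≢sx = suc-<ᵇ x b b≢sx
  ... | _ | second         | _ | first          = contradiction (inj₂ (refl , refl)) ¬swap
  ... | _ | second         | _ | second         = refl
  ... | _ | second         | _ | fixes b≢x b≢sx = sym (suc-<ᵇ x b b≢sx)
  ... | _ | fixes a≢x a≢sx | _ | first          = <ᵇ-suc a x a≢x
  ... | _ | fixes a≢x a≢sx | _ | second         = sym (<ᵇ-suc a x a≢x)
  ... | _ | fixes _ _      | _ | fixes _ _      = refl

  tie⇒separated : ∀ {l} → Unique l → positionParity l x ≡ positionParity l (suc x) →
                  Linked (λ a b → ¬ SwapPair a b) l
  tie⇒separated {l} l! tie = Linked.map apart (positionParity-alternates l!)
    where
    apart : ∀ {a b} → positionParity l b ≡ positionParity l a ⁻¹ → ¬ SwapPair a b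
    apart alt (inj₁ (refl , refl)) = ℙₚ.p≢p⁻¹ _ (trans tie alt)
    apart alt (inj₂ (refl , refl)) = ℙₚ.p≢p⁻¹ _ (trans (sym tie) alt)

  ascents-τ : ∀ {l} → Unique l → positionParity l x ≡ positionParity l (suc x) →
              ascents (map τ l) ≡ ascents l
  ascents-τ l! tie = ascents-map τ (Linked.map (τ-<ᵇ _ _) (tie⇒separated l! tie))

  inversions-τ-absent : ∀ {l} → x ∉ l ⊎ suc x ∉ l → inversions (map τ l) ≡ inversions l
  inversions-τ-absent {l} absent = inversions-map τ l (λ a∈ b∈ → τ-<ᵇ _ _ (¬swap absent b∈ a∈))
    where
    ¬swap : x ∉ l ⊎ suc x ∉ l → ∀ {a b} → a ∈ l → b ∈ l → ¬ SwapPair a b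
    ¬swap (inj₁ x∉)  a∈ b∈ (inj₁ (refl , _)) = x∉ a∈
    ¬swap (inj₁ x∉)  a∈ b∈ (inj₂ (_ , refl)) = x∉ b∈
    ¬swap (inj₂ sx∉) a∈ b∈ (inj₁ (_ , refl)) = sx∉ b∈
    ¬swap (inj₂ sx∉) a∈ b∈ (inj₂ (refl , _)) = sx∉ a∈

  τ-<ᵇ-suc : ∀ c → c ≢ suc x → (τ c <ᵇ suc x) ≡ (c <ᵇ x)
  τ-<ᵇ-suc c c≢sx = trans (cong (τ c <ᵇ_) (sym (transpose-matchˡ _≟_ x (suc x)))) (τ-<ᵇ c x ¬swap)
    where
    ¬swap : ¬ SwapPair c x
    ¬swap (inj₁ (_ , x≡sx)) = <-irrefl x≡sx (n<1+n x)
    ¬swap (inj₂ (c≡sx , _)) = c≢sx c≡sx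

  map-τ-involutive : ∀ l → map τ (map τ l) ≡ l
  map-τ-involutive l =
    trans (sym (map-∘ l)) (trans (map-cong (transpose-involutive _≟_ x (suc x)) l) (map-id l))

  invFrom-τ : ∀ {t} → Unique t → suc x ∈ t → invFrom (suc x) (map τ t) ≡ suc (invFrom x t)
  invFrom-τ {_ ∷ t} (sx∉ ∷ _) (here refl) = begin
    indicator (τ (suc x) <ᵇ suc x) + invFrom (suc x) (map τ t)
      ≡⟨ cong (λ c → indicator (c <ᵇ suc x) + invFrom (suc x) (map τ t)) (transpose-matchʳ _≟_ x (suc x)) ⟩
    indicator (x <ᵇ suc x) + invFrom (suc x) (map τ t)
      ≡⟨ cong₂ _+_ (cong indicator (n<ᵇ1+n x))
                   (invFrom-map τ t (λ c∈ → τ-<ᵇ-suc _ (λ { refl → All.lookup sx∉ c∈ refl }))) ⟩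
    suc (invFrom x t)
      ≡⟨ cong (λ c → suc (indicator c + invFrom x t)) (1+n<ᵇn x) ⟨
    suc (indicator (suc x <ᵇ x) + invFrom x t)
      ∎
  invFrom-τ {b ∷ t} (b∉ ∷ t!) (there sx∈) =
    trans (cong₂ _+_ (cong indicator (τ-<ᵇ-suc b (All.lookup b∉ sx∈))) (invFrom-τ t! sx∈)) (+-suc _ _)

  invFrom-τ′ : ∀ {t} → Unique t → x ∈ t → invFrom (suc x) t ≡ suc (invFrom x (map τ t))
  invFrom-τ′ {t} t! x∈ = begin
    invFrom (suc x) t                  ≡⟨ cong (invFrom (suc x)) (map-τ-involutive t) ⟨
    invFrom (suc x) (map τ (map τ t))  ≡⟨ invFrom-τ (Unique.map⁺ τ-injective t!) sx∈ ⟩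
    suc (invFrom x (map τ t))          ∎
    where
    sx∈ : suc x ∈ map τ t
    sx∈ = subst (_∈ map τ t) (transpose-matchˡ _≟_ x (suc x)) (∈-map⁺ τ x∈)

  inversions-τ : ∀ {l} → Unique l → x ∈ l → suc x ∈ l → DifferByOne (inversions (map τ l)) (inversions l)
  inversions-τ {a ∷ t} (a∉ ∷ t!) x∈ sx∈ with τ a | transposes _≟_ x (suc x) a
  ... | _ | first = inj₁ (cong₂ _+_
    (invFrom-τ t! (Any.tail (λ sx≡x → <-irrefl (sym sx≡x) (n<1+n x)) sx∈))
    (inversions-τ-absent (inj₁ λ x∈t → All.lookup a∉ x∈t refl)))
  ... | _ | second = inj₂ (cong₂ _+_
    (invFrom-τ′ t! (Any.tail (λ x≡sx → <-irrefl x≡sx (n<1+n x)) x∈))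
    (sym (inversions-τ-absent (inj₂ λ sx∈t → All.lookup a∉ sx∈t refl))))
  ... | _ | fixes a≢x a≢sx = subst (λ i → DifferByOne (i + _) _) (sym unchanged)
    (differByOne-+ˡ (invFrom a t) (inversions-τ t! (Any.tail (a≢x ∘ sym) x∈) (Any.tail (a≢sx ∘ sym) sx∈)))
    where
    ¬swap : ∀ {b} → ¬ SwapPair b a
    ¬swap (inj₁ (_ , a≡sx)) = a≢sx a≡sx
    ¬swap (inj₂ (_ , a≡x))  = a≢x a≡x
    unchanged : invFrom a (map τ t) ≡ invFrom a t
    unchanged = invFrom-map τ t λ {b} _ →
      trans (cong (τ b <ᵇ_) (sym (transpose-fixes _≟_ a≢x a≢sx))) (τ-<ᵇ b a ¬swap)

  positionParity-τ : ∀ l → positionParity l x ≡ positionParity l (suc x) →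
                     ∀ v → positionParity (map τ l) v ≡ positionParity l v
  positionParity-τ l tie v = begin
    positionParity (map τ l) v        ≡⟨ cong (positionParity (map τ l)) (transpose-involutive _≟_ x (suc x) v) ⟨
    positionParity (map τ l) (τ (τ v)) ≡⟨ cong parity (position-map τ τ-injective (τ v) l) ⟩
    positionParity l (τ v)            ≡⟨ tied (τ v) (transposes _≟_ x (suc x) v) ⟩
    positionParity l v                ∎
    where
    tied : ∀ w {v} → Transposes _≟_ x (suc x) v w → positionParity l w ≡ positionParity l v
    tied _ first       = sym tie
    tied _ second      = tie
    tied _ (fixes _ _) = refl

-- The involution

-- The entry k : Fin n of a word has the one-line value suc (toℕ k), so the index i found here
-- stands for the values i + 1 and i + 2, i.e. the entries inject₁ i and suc i.
firstTie : ∀ {m} → (ℕ → Parity) → Maybe (Fin m)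
firstTie {m} p = find (λ i → p (suc (toℕ i)) ℙₚ.≟ p (suc (suc (toℕ i)))) (allFin m)

firstTie-cong : ∀ {m} {p q : ℕ → Parity} → (∀ v → p v ≡ q v) → firstTie {m} p ≡ firstTie q
firstTie-cong {m} p≗q = find-cong _ _ (λ i → cong₂ (λ a b → does (a ℙₚ.≟ b)) (p≗q _) (p≗q _)) (allFin m)

swapValues : ∀ {m k} → Fin m → Vec (Fin (suc m)) k → Vec (Fin (suc m)) k
swapValues i = Vec.map (transpose Finₚ._≟_ (inject₁ i) (Fin.suc i))

swapFirstTie : ∀ {n} → Vec (Fin n) n → Vec (Fin n) n
swapFirstTie {zero}  w = w
swapFirstTie {suc m} w = maybe′ (λ i → swapValues i w) w (firstTie (positionParity (oneLine w)))

oneLine-swapValues : ∀ {m} (i : Fin m) (w : Vec (Fin (suc m)) (suc m)) →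
                     oneLine (swapValues i w) ≡ map (Adjacent.τ (suc (toℕ i))) (oneLine w)
oneLine-swapValues i w = begin
  map val (toList (Vec.map g w))  ≡⟨ cong (map val) (Vecₚ.toList-map g w) ⟩
  map val (map g (toList w))      ≡⟨ map-∘ (toList w) ⟨
  map (val ∘ g) (toList w)        ≡⟨ map-cong val∘g≗τ∘val (toList w) ⟩
  map (τ ∘ val) (toList w)        ≡⟨ map-∘ (toList w) ⟩
  map τ (map val (toList w))      ∎
  where
  open Adjacent (suc (toℕ i))
  val : Fin _ → ℕ
  val k = suc (toℕ k)
  g : Fin _ → Fin _
  g = transpose Finₚ._≟_ (inject₁ i) (Fin.suc i)
  val∘g≗τ∘val : ∀ k → val (g k) ≡ τ (val k)
  val∘g≗τ∘val k = trans
    (transpose-natural Finₚ._≟_ _≟_ val (Finₚ.toℕ-injective ∘ suc-injective) (inject₁ i) (Fin.suc i) k)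
    (cong (λ a → transpose _≟_ a (suc (suc (toℕ i))) (val k)) (cong suc (Finₚ.toℕ-inject₁ i)))

swapValues-involutive : ∀ {m k} (i : Fin m) (w : Vec (Fin (suc m)) k) → swapValues i (swapValues i w) ≡ w
swapValues-involutive i w = trans (sym (Vecₚ.map-∘ g g w))
  (trans (Vecₚ.map-cong (transpose-involutive Finₚ._≟_ (inject₁ i) (Fin.suc i)) w) (Vecₚ.map-id w))
  where
  g : Fin _ → Fin _
  g = transpose Finₚ._≟_ (inject₁ i) (Fin.suc i)

record SignReversal {n} (w w′ : Vec (Fin n) n) : Set where
  field
    isPerm          : IsPerm w′
    same-ascents    : ascents (oneLine w′) ≡ ascents (oneLine w)
    not-alternating : parityAlternating (oneLine w′) ≡ false
    opposite-sign   : inversions (oneLine w′) % 2 ≡ 1 ∸ inversions (oneLine w) % 2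

swapValues-reverses : ∀ {m} (i : Fin m) (w : Vec (Fin (suc m)) (suc m)) → IsPerm w →
                      let x = suc (toℕ i) in
                      positionParity (oneLine w) x ≡ positionParity (oneLine w) (suc x) →
                      SignReversal w (swapValues i w)
swapValues-reverses i w w-perm tie = record
  { isPerm          = isPerm-map (transpose-injective Finₚ._≟_ (inject₁ i) (Fin.suc i)) {w} w-perm
  ; same-ascents    = trans (cong ascents swapped) (ascents-τ l! tie)
  ; not-alternating = trans (cong parityAlternating swapped) (tie⇒¬alternating x∈′ sx∈′ tie′)
  ; opposite-sign   = trans (cong (λ l → inversions l % 2) swapped) (%2-differByOne (inversions-τ l! x∈ sx∈))
  }
  where
  x : ℕ
  x = suc (toℕ i)
  open Adjacent x
  l : List ℕ
  l = oneLine w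
  l! : Unique l
  l! = oneLine-unique w-perm
  swapped : oneLine (swapValues i w) ≡ map τ l
  swapped = oneLine-swapValues i w
  x∈ : x ∈ l
  x∈ = subst (_∈ l) (cong suc (Finₚ.toℕ-inject₁ i)) (∈-oneLine w-perm (inject₁ i))
  sx∈ : suc x ∈ l
  sx∈ = ∈-oneLine w-perm (Fin.suc i)
  x∈′ : x ∈ map τ l
  x∈′ = subst (_∈ map τ l) (transpose-matchʳ _≟_ x (suc x)) (∈-map⁺ τ sx∈)
  sx∈′ : suc x ∈ map τ l
  sx∈′ = subst (_∈ map τ l) (transpose-matchˡ _≟_ x (suc x)) (∈-map⁺ τ x∈)
  tie′ : positionParity (map τ l) x ≡ positionParity (map τ l) (suc x)
  tie′ = trans (positionParity-τ l tie x) (trans tie (sym (positionParity-τ l tie (suc x))))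

noTie⇒alternating : ∀ {m} (w : Vec (Fin (suc m)) (suc m)) → IsPerm w →
                    firstTie {m} (positionParity (oneLine w)) ≡ nothing → parityAlternating (oneLine w) ≡ true
noTie⇒alternating {m} w w-perm none = defect≡⇒alternating (oneLine-unique w-perm) constant
  where
  l : List ℕ
  l = oneLine w
  untied : ∀ {t} → t < m → positionParity l (suc t) ≢ positionParity l (suc (suc t))
  untied t<m = subst (λ s → positionParity l (suc s) ≢ positionParity l (suc (suc s))) (Finₚ.toℕ-fromℕ< t<m)
    (All.lookup (find-nothing _ (allFin m) none) (∈-allFin (fromℕ< t<m)))
  from-1 : ∀ t → t < suc m → defect l (suc t) ≡ defect l 1
  from-1 zero    _         = refl
  from-1 (suc t) (s≤s t<m) = trans (defect-suc l (suc t) (untied t<m ∘ sym)) (from-1 t (m<n⇒m<1+n t<m))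
  constant : ∀ {v} → v ∈ l → defect l v ≡ defect l 1
  constant v∈ with k , refl ← oneLine-values v∈ = from-1 (toℕ k) (Finₚ.toℕ<n k)

swapFirstTie-involutive : ∀ {n} (w : Vec (Fin n) n) → swapFirstTie (swapFirstTie w) ≡ w
swapFirstTie-involutive {zero}  w = refl
swapFirstTie-involutive {suc m} w with firstTie {m} (positionParity (oneLine w)) in found
... | nothing rewrite found = refl
... | just i = begin
  swapFirstTie w′                ≡⟨ cong (maybe′ (λ j → swapValues j w′) w′) (trans (firstTie-cong same) found) ⟩
  swapValues i w′                ≡⟨ swapValues-involutive i w ⟩
  w                              ∎
  where
  w′ : Vec (Fin (suc m)) (suc m)
  w′ = swapValues i w
  same : ∀ v → positionParity (oneLine w′) v ≡ positionParity (oneLine w) v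
  same v = trans (cong (λ l → positionParity l v) (oneLine-swapValues i w))
    (Adjacent.positionParity-τ _ (oneLine w) (find-just _ (allFin m) found) v)

swapFirstTie-reverses : ∀ {n} (w : Vec (Fin n) n) → IsPerm w → parityAlternating (oneLine w) ≡ false →
                        SignReversal w (swapFirstTie w)
swapFirstTie-reverses {zero}  [] _ ()
swapFirstTie-reverses {suc m} w w-perm ¬alt with firstTie {m} (positionParity (oneLine w)) in found
... | nothing = contradiction (trans (sym (noTie⇒alternating w w-perm found)) ¬alt) λ ()
... | just i  = swapValues-reverses i w w-perm (find-just _ (allFin m) found)

theorem3 : (n k : ℕ) → 0 < n → k < n → countN n k 0 ≡ countN n k 1
theorem3 n k _ _ = length-≡-by-involution swapFirstTie swapFirstTie-involutive
  (Unique.filter⁺ (N? 0) (perms-unique n)) (Unique.filter⁺ (N? 1) (perms-unique n)) (partner 0) (partner 1)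
  where
  N? : ∀ r (w : Vec (Fin n) n) → Dec (ascents (oneLine w) ≡ k × parityAlternating (oneLine w) ≡ false
                                      × inversions (oneLine w) % 2 ≡ r)
  N? r w = (ascents (oneLine w) ≟ k) ×-dec (parityAlternating (oneLine w) Boolₚ.≟ false)
             ×-dec (inversions (oneLine w) % 2 ≟ r)
  partner : ∀ r {w} → w ∈ filter (N? r) (perms n) → swapFirstTie w ∈ filter (N? (1 ∸ r)) (perms n)
  partner r {w} w∈ with w∈perms , asc , ¬alt , inv ← ∈-filter⁻ (N? r) {xs = perms n} w∈ =
    ∈-filter⁺ (N? (1 ∸ r)) (∈-perms⁺ isPerm) (trans same-ascents asc , not-alternating , trans opposite-sign (cong (1 ∸_) inv))
    where open SignReversal (swapFirstTie-reverses w (∈-perms⁻ w∈perms) ¬alt)
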